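{- Let $G$ be a finite simple graph. A proper coloring of $G$ is IF-compelling if and only if it is TDom-compelling.
   Context: A proper coloring partitions $V(G)$ into nonempty independent color classes. Given a proper coloring, a rainbow committee (RC) is a set consisting of exactly one vertex of each color. A proper coloring compels a property $\mathcal{P}$ of vertex subsets if every RC has $\mathcal{P}$. Property IF: every vertex in the RC has a neighbor in the RC (the subgraph induced by the RC has no isolated vertices). Property TDom: every vertex of $G$ has a neighbor in the RC. -}

module Defs where

open import Data.Nat using (ℕ)
open import Data.Fin using (Fin)
open import Data.Product using (Σ; ∃; _×_; _,_)
open import Relation.Nullary using (¬_; Dec)
open import Relation.Binary.PropositionalEquality using (_≡_; _≢_)
open import Level using (0ℓ; suc)

record SimpleGraph (n : ℕ) : Set₁ where
  field
    Adj   : Fin n → Fin n → Set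
    dec   : ∀ u v → Dec (Adj u v)
    sym   : ∀ {u v} → Adj u v → Adj v u
    irrefl : ∀ {v} → ¬ Adj v v

open SimpleGraph public

record ProperColoring {n : ℕ} (G : SimpleGraph n) : Set where
  field
    k        : ℕ
    color    : Fin n → Fin k
    nonempty : ∀ (i : Fin k) → ∃ λ v → color v ≡ i
    proper   : ∀ {u v} → Adj G u v → color u ≢ color v

open ProperColoring public

-- A rainbow committee: exactly one vertex of each color, given as the
-- choice of a vertex r i of color i for every color i.
RainbowCommittee : ∀ {n} {G : SimpleGraph n} → ProperColoring G → Set
RainbowCommittee {n} c = Σ (Fin (k c) → Fin n) λ r → ∀ i → color c (r i) ≡ i

IF : ∀ {n} (G : SimpleGraph n) (c : ProperColoring G) → RainbowCommittee c → Set
IF G c (r , _) = ∀ (i : Fin (k c)) → ∃ λ j → Adj G (r i) (r j)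

TDom : ∀ {n} (G : SimpleGraph n) (c : ProperColoring G) → RainbowCommittee c → Set
TDom {n} G c (r , _) = ∀ (v : Fin n) → ∃ λ j → Adj G v (r j)

Compels : ∀ {n} {G : SimpleGraph n} (c : ProperColoring G) →
          (RainbowCommittee c → Set) → Set
Compels c P = ∀ (R : RainbowCommittee c) → P R

IF-compelling : ∀ {n} {G : SimpleGraph n} → ProperColoring G → Set
IF-compelling {G = G} c = Compels c (IF G c)

TDom-compelling : ∀ {n} {G : SimpleGraph n} → ProperColoring G → Set
TDom-compelling {G = G} c = Compels c (TDom G c)

{-# OPTIONS --safe #-}
-- Replacing the member of colour c(v) in a rainbow committee by v gives another
-- rainbow committee. If IF is compelled, v has a neighbour in it, which cannot be
-- v itself, so it is a member of the original committee: TDom holds. Conversely,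
-- TDom applied to the committee's own members is exactly IF.
module Submission where

open import Defs
open import Data.Nat using (ℕ)
open import Data.Fin using (Fin; _≟_)
open import Data.Product using (_×_; _,_)
open import Data.Empty using (⊥-elim)
open import Data.Vec.Functional using (updateAt)
open import Data.Vec.Functional.Properties using (updateAt-updates; updateAt-minimal)
open import Function using (const)
open import Relation.Nullary using (yes; no)
open import Relation.Binary.PropositionalEquality using (_≡_; refl; cong; trans; subst₂)

module _ {n : ℕ} {G : SimpleGraph n} (c : ProperColoring G) where

  withMember : RainbowCommittee c → Fin n → RainbowCommittee c
  withMember (r , rainbow) v = updateAt r (color c v) (const v) , rainbow′
    where
    rainbow′ : ∀ j → color c (updateAt r (color c v) (const v) j) ≡ j
    rainbow′ j with j ≟ color c v
    ... | yes refl = cong (color c) (updateAt-updates (color c v) r)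
    ... | no j≢cv  = trans (cong (color c) (updateAt-minimal j (color c v) r j≢cv)) (rainbow j)

  TDom⇒IF : ∀ R → TDom G c R → IF G c R
  TDom⇒IF (r , _) dom i = dom (r i)

  IF-compelling⇒TDom-compelling : IF-compelling c → TDom-compelling c
  IF-compelling⇒TDom-compelling if R@(r , _) v with if (withMember R v) (color c v)
  ... | j , adj with j ≟ color c v
  ... | yes refl = ⊥-elim (irrefl G adj)
  ... | no j≢cv  = j , subst₂ (Adj G) (updateAt-updates (color c v) r)
                                      (updateAt-minimal j (color c v) r j≢cv) adj

  TDom-compelling⇒IF-compelling : TDom-compelling c → IF-compelling c
  TDom-compelling⇒IF-compelling dom R = TDom⇒IF R (dom R)

mainTheorem2 : ∀ (n : ℕ) (G : SimpleGraph n) (c : ProperColoring G) →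
    (IF-compelling c → TDom-compelling c) × (TDom-compelling c → IF-compelling c)
mainTheorem2 n G c = IF-compelling⇒TDom-compelling c , TDom-compelling⇒IF-compelling c
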